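{- Let $G$ be a $2$-connected planar graph with $\Delta(G)\leq 4$ that admits an interval coloring. Then $W(G)\leq \frac{3}{2}|V(G)|$.
   Context: Graphs are finite with no loops and no multiple edges. For a positive integer $t$, an interval $t$-coloring of a graph $G$ is a proper edge coloring $\alpha:E(G)\to\{1,\dots,t\}$ in which every color $1,\dots,t$ is used and, for every vertex $v$, the set of colors on the edges incident to $v$ is an interval of consecutive integers. For a graph $G$ having an interval coloring, $W(G)$ denotes the maximum $t$ such that $G$ has an interval $t$-coloring. $\Delta(G)$ is the maximum degree. -}

module Defs where

open import Data.Nat using (ℕ; zero; suc; _+_; _*_; _≤_; _<ᵇ_)
open import Data.Fin using (Fin; toℕ)
open import Data.Bool using (Bool; true; false; if_then_else_; _∧_)
open import Data.List using (List; map; allFin)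
open import Data.Nat.ListAction using (sum)
open import Data.Product using (_×_; _,_; ∃; ∃-syntax; Σ-syntax)
open import Data.Unit using (⊤)
open import Relation.Binary.PropositionalEquality using (_≡_; _≢_)
open import Function.Bundles using (_⇔_)

record Graph : Set where
  field
    n       : ℕ
    adj     : Fin n → Fin n → Bool
    adj-sym : ∀ u v → adj u v ≡ adj v u
    adj-irr : ∀ v → adj v v ≡ false

open Graph public

Adj : (G : Graph) → Fin (n G) → Fin (n G) → Set
Adj G u v = adj G u v ≡ true

degree : (G : Graph) → Fin (n G) → ℕ
degree G v = sum (map (λ w → if adj G v w then 1 else 0) (allFin (n G)))

MaxDegreeAtMost : Graph → ℕ → Set
MaxDegreeAtMost G k = ∀ v → degree G v ≤ k

numEdges : Graph → ℕ
numEdges G = sum (map (λ u → sum (map (λ v → if adj G u v ∧ (toℕ u <ᵇ toℕ v) then 1 else 0)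
                                        (allFin (n G))))
                      (allFin (n G)))

data Walk (G : Graph) (P : Fin (n G) → Set) : Fin (n G) → Fin (n G) → Set where
  here : ∀ {u} → P u → Walk G P u u
  step : ∀ {u w v} → P u → Adj G u w → Walk G P w v → Walk G P u v

Connected : Graph → Set
Connected G = ∀ u v → Walk G (λ _ → ⊤) u v

-- 2-connected: at least 3 vertices, connected, and no cut vertex
TwoConnected : Graph → Set
TwoConnected G =
  (3 ≤ n G) × Connected G ×
  (∀ x u v → u ≢ x → v ≢ x → Walk G (λ w → w ≢ x) u v)

iter : {A : Set} → (A → A) → ℕ → A → A
iter f zero    a = a
iter f (suc k) a = f (iter f k a)

-- Planarity, via combinatorial embeddings (rotation systems) of genus 0.
-- rot u is the cyclic successor among the neighbours of u; faces are the
-- orbits of the dart map (u , v) ↦ (v , rot v u); Euler's formula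
-- |V| - |E| + |F| = 2 characterises genus 0 (for connected graphs with an edge).
record PlanarEmbedding (G : Graph) : Set where
  field
    rot        : Fin (n G) → Fin (n G) → Fin (n G)
    rot-adj    : ∀ u v → Adj G u v → Adj G u (rot u v)
    rot-inj    : ∀ u v w → Adj G u v → Adj G u w → rot u v ≡ rot u w → v ≡ w
    rot-cyclic : ∀ u v w → Adj G u v → Adj G u w → ∃[ k ] iter (rot u) k v ≡ w
  faceStep : Fin (n G) × Fin (n G) → Fin (n G) × Fin (n G)
  faceStep (u , v) = (v , rot v u)
  field
    faces      : ℕ
    face       : ∀ u v → Adj G u v → Fin faces
    face-surj  : ∀ i → ∃[ u ] ∃[ v ] Σ[ p ∈ Adj G u v ] face u v p ≡ i
    face-orbit : ∀ u v u' v' (p : Adj G u v) (p' : Adj G u' v') →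
                 (face u v p ≡ face u' v' p') ⇔ (∃[ k ] iter faceStep k (u , v) ≡ (u' , v'))
    euler      : n G + faces ≡ 2 + numEdges G

Planar : Graph → Set
Planar G = PlanarEmbedding G

record IntervalColoring (G : Graph) (t : ℕ) : Set where
  field
    col       : Fin (n G) → Fin (n G) → ℕ
    col-sym   : ∀ u v → Adj G u v → col u v ≡ col v u
    col-range : ∀ u v → Adj G u v → (1 ≤ col u v) × (col u v ≤ t)
    proper    : ∀ u v w → Adj G u v → Adj G u w → col u v ≡ col u w → v ≡ w
    all-used  : ∀ c → 1 ≤ c → c ≤ t → ∃[ u ] ∃[ v ] (Adj G u v × col u v ≡ c)
  ColorAt : Fin (n G) → ℕ → Set
  ColorAt v c = ∃[ w ] (Adj G v w × col v w ≡ c)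
  field
    interval  : ∀ v a b c → a ≤ c → c ≤ b → ColorAt v a → ColorAt v b → ColorAt v c

HasIntervalColoring : Graph → Set
HasIntervalColoring G = ∃[ t ] IntervalColoring G t

-- W(G) ≤ 3/2 |V(G)|, i.e. every interval t-coloring has 2t ≤ 3|V(G)|
-- (W(G) is the maximum such t).
WAtMostThreeHalvesV : Graph → Set
WAtMostThreeHalvesV G = ∀ t → IntervalColoring G t → 2 * t ≤ 3 * n G

module Submission where

-- Fix an interval t-colouring.  Say that a vertex
-- v crosses level s when v sees both colours s and s+1.
--   * Since Δ ≤ 4 and colours at v form an interval, v sees at most four
--     consecutive colours, so v crosses at most three consecutive levels.
--   * For 1 ≤ s < t, walking from an edge of colour s to an edge of colour
--     s+1 meets a vertex crossing s; as G has no cut vertex, repeating the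
--     walk avoiding that vertex gives a second one.
-- Hence the levels r, r+3, r+6, … ("windows") are crossed by pairwise
-- disjoint sets of at least two vertices each, and counting gives 2k ≤ n
-- for k windows.  Writing t = 3k, 3k+2 or 3k+1 this proves 2t ≤ 3n, except
-- for t = 3k+1, where one more vertex outside suitable windows is found by
-- inspecting the ends of the edge of colour 1.

open import Defs
open import Data.Nat using (ℕ; zero; suc; _+_; _*_; _≤_; _<_; z≤n; s≤s; _≤?_; _≟_)
open import Data.Nat.Properties
open import Data.Nat.Tactic.RingSolver using (solve-∀)
open import Data.Fin using (Fin) renaming (zero to fzero; suc to fsuc)
open import Data.Fin.Properties using (injective⇒≤; any?) renaming (_≟_ to _≟ᶠ_)
open import Data.Bool using (Bool; true; false; if_then_else_)
import Data.Bool.Properties as Bool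
open import Data.List using (List; []; _∷_; length; map; allFin; _++_; lookup; filter)
open import Data.List.Properties using (length-tabulate; length-++)
open import Data.List.Relation.Unary.All as All using (All; []; _∷_)
open import Data.List.Relation.Unary.Any using (index)
open import Data.List.Relation.Unary.Any.Properties using (lookup-index)
open import Data.List.Relation.Unary.Unique.Propositional using (Unique; []; _∷_)
open import Data.List.Relation.Unary.Unique.Propositional.Properties using (++⁺)
open import Data.List.Membership.Propositional using (_∈_)
open import Data.List.Membership.Propositional.Properties using (∈-lookup; ∈-allFin; ∈-filter⁺)
open import Data.Nat.ListAction using (sum)
open import Data.Product using (Σ-syntax; ∃-syntax; _×_; _,_; proj₁)
open import Data.Sum using (_⊎_; inj₁; inj₂)
open import Data.Empty using (⊥; ⊥-elim)
open import Relation.Nullary using (¬_; Dec; yes; no)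
open import Relation.Nullary.Decidable using (_×-dec_)
open import Relation.Binary.PropositionalEquality
open import Relation.Binary.Definitions using (tri<; tri≈; tri>)

≤-by : ∀ {m n} d → m + d ≡ n → m ≤ n
≤-by {m} d refl = m≤m+n m d

residue-3 : ∀ m → ∃[ k ] (m ≡ 3 * k ⊎ m ≡ 1 + 3 * k ⊎ m ≡ 2 + 3 * k)
residue-3 zero = 0 , inj₁ refl
residue-3 (suc m) with residue-3 m
... | k , inj₁ e        = k , inj₂ (inj₁ (cong suc e))
... | k , inj₂ (inj₁ e) = k , inj₂ (inj₂ (cong suc e))
... | k , inj₂ (inj₂ e) = suc k , inj₁ (trans (cong suc e) (sym (*-suc 3 k)))

-- Arithmetic for the three residues of t modulo 3.  A family of k windows
-- of offset r fits below t when r + 3k ≤ t + 2 (see windows-fit below).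

-- t = 3k: k windows of offset 1, and 2t = 3 · 2k.
residue-0-fit : ∀ k → 1 + 3 * k ≤ 3 * k + 2
residue-0-fit k = ≤-by 1 (shape k)
  where
  shape : ∀ k → (1 + 3 * k) + 1 ≡ 3 * k + 2
  shape = solve-∀

residue-0-bound : ∀ k → 2 * (3 * k) ≡ 3 * (k + k)
residue-0-bound = solve-∀

-- t = 3k + 2: k + 1 windows of offset 1, and 2t ≤ 3 · 2(k + 1).
residue-2-fit : ∀ k → 1 + 3 * suc k ≤ (2 + 3 * k) + 2
residue-2-fit k = ≤-reflexive (shape k)
  where
  shape : ∀ k → 1 + 3 * suc k ≡ (2 + 3 * k) + 2
  shape = solve-∀

residue-2-bound : ∀ k → 2 * (2 + 3 * k) ≤ 3 * (suc k + suc k)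
residue-2-bound k = ≤-by 2 (shape k)
  where
  shape : ∀ k → 2 * (2 + 3 * k) + 2 ≡ 3 * (suc k + suc k)
  shape = solve-∀

-- t = 3K + 1 with K = k + 1: K windows of offset ≤ 3 fit, or K - 1 windows
-- of offset ≤ 6; three extra vertices with 2(K - 1) give 2K + 1; and
-- 2t ≤ 3(2K + 1).
offsets-fit-K : ∀ k r → r ≤ 3 → r + 3 * suc k ≤ (1 + 3 * suc k) + 2
offsets-fit-K k r r≤3 = ≤-trans (+-monoˡ-≤ (3 * suc k) r≤3) (≤-reflexive (shape (3 * suc k)))
  where
  shape : ∀ x → 3 + x ≡ (1 + x) + 2
  shape = solve-∀

offsets-fit-K-1 : ∀ k r → r ≤ 6 → r + 3 * k ≤ (1 + 3 * suc k) + 2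
offsets-fit-K-1 k r r≤6 = ≤-trans (+-monoˡ-≤ (3 * k) r≤6) (≤-reflexive (shape k))
  where
  shape : ∀ k → 6 + 3 * k ≡ (1 + 3 * suc k) + 2
  shape = solve-∀

three-plus-twice : ∀ k → 3 + (k + k) ≡ 1 + (suc k + suc k)
three-plus-twice = solve-∀

residue-1-bound : ∀ k → 2 * (1 + 3 * suc k) ≤ 3 * (1 + (suc k + suc k))
residue-1-bound k = ≤-by 1 (shape k)
  where
  shape : ∀ k → 2 * (1 + 3 * suc k) + 1 ≡ 3 * (1 + (suc k + suc k))
  shape = solve-∀

module _ {A : Set} where

  lookup-injective : (L : List A) → Unique L → ∀ i j → lookup L i ≡ lookup L j → i ≡ j
  lookup-injective (x ∷ L) (x∉L ∷ uL) fzero    fzero    e = refl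
  lookup-injective (x ∷ L) (x∉L ∷ uL) fzero    (fsuc j) e = ⊥-elim (All.lookup x∉L (∈-lookup j) e)
  lookup-injective (x ∷ L) (x∉L ∷ uL) (fsuc i) fzero    e = ⊥-elim (All.lookup x∉L (∈-lookup i) (sym e))
  lookup-injective (x ∷ L) (x∉L ∷ uL) (fsuc i) (fsuc j) e = cong fsuc (lookup-injective L uL i j e)

  unique-⊆-length : (L M : List A) → Unique L → (∀ {x} → x ∈ L → x ∈ M) → length L ≤ length M
  unique-⊆-length L M uL L⊆M = injective⇒≤ position-injective
    where
    position : Fin (length L) → Fin (length M)
    position i = index (L⊆M (∈-lookup i))

    position-injective : ∀ {i j} → position i ≡ position j → i ≡ j
    position-injective {i} {j} e = lookup-injective L uL i j (begin
      lookup L i            ≡⟨ lookup-index (L⊆M (∈-lookup i)) ⟩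
      lookup M (position i) ≡⟨ cong (lookup M) e ⟩
      lookup M (position j) ≡⟨ sym (lookup-index (L⊆M (∈-lookup j))) ⟩
      lookup L j            ∎)
      where open ≡-Reasoning

  length-filter-≡true : (f : A → Bool) (xs : List A) →
    length (filter (λ x → f x Bool.≟ true) xs) ≡ sum (map (λ x → if f x then 1 else 0) xs)
  length-filter-≡true f []       = refl
  length-filter-≡true f (x ∷ xs) with f x
  ... | true  = cong suc (length-filter-≡true f xs)
  ... | false = length-filter-≡true f xs

module GraphFacts (G : Graph) where

  Vertex : Set
  Vertex = Fin (n G)

  adj⇒≢ : ∀ {u v} → Adj G u v → u ≢ v
  adj⇒≢ {u} a refl with trans (sym a) (adj-irr G u)
  ... | ()

  Adj-sym : ∀ {u v} → Adj G u v → Adj G v u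
  Adj-sym {u} {v} a = trans (adj-sym G v u) a

  neighbours : Vertex → List Vertex
  neighbours v = filter (λ w → adj G v w Bool.≟ true) (allFin (n G))

  neighbours-bound : ∀ v (L : List Vertex) → Unique L → All (Adj G v) L → length L ≤ degree G v
  neighbours-bound v L uL adjL = begin
    length L              ≤⟨ unique-⊆-length L (neighbours v) uL L⊆N ⟩
    length (neighbours v) ≡⟨ length-filter-≡true (adj G v) (allFin (n G)) ⟩
    degree G v            ∎
    where
    open ≤-Reasoning
    L⊆N : ∀ {w} → w ∈ L → w ∈ neighbours v
    L⊆N w∈L = ∈-filter⁺ (λ w → adj G v w Bool.≟ true) (∈-allFin _) (All.lookup adjL w∈L)

module Colouring (G : Graph) (t : ℕ) (C : IntervalColoring G t) where
  open IntervalColoring C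
  open GraphFacts G

  colourAt-other-end : ∀ {u v} → (a : Adj G u v) → ColorAt v (col u v)
  colourAt-other-end {u} {v} a = u , Adj-sym a , sym (col-sym u v a)

  colourAt? : ∀ v c → Dec (ColorAt v c)
  colourAt? v c = any? (λ w → (adj G v w Bool.≟ true) ×-dec (col v w ≟ c))

  missing-colour : ∀ v c m d → c ≤ m → m ≤ d → ColorAt v c → ¬ ColorAt v m → ¬ ColorAt v d
  missing-colour v c m d c≤m m≤d hc ¬hm hd = ¬hm (interval v c d m c≤m m≤d hc hd)

  colour-run-neighbours : ∀ v c k → (∀ i → i ≤ k → ColorAt v (i + c)) →
    Σ[ L ∈ List Vertex ] (length L ≡ suc k × Unique L × All (λ w → Adj G v w × col v w < suc k + c) L)
  colour-run-neighbours v c zero run with run 0 z≤n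
  ... | w , vw , refl = w ∷ [] , refl , [] ∷ [] , (vw , ≤-refl) ∷ []
  colour-run-neighbours v c (suc k) run
    with colour-run-neighbours v c k (λ i i≤k → run i (m≤n⇒m≤1+n i≤k)) | run (suc k) ≤-refl
  ... | L , len , uL , below | w , vw , w-colour =
    w ∷ L , cong suc len , All.map fresh below ∷ uL ,
    (vw , s≤s (≤-reflexive w-colour)) ∷ All.map (λ (vx , lt) → vx , m<n⇒m<1+n lt) below
    where
    fresh : ∀ {x} → Adj G v x × col v x < suc k + c → w ≢ x
    fresh (_ , lt) refl = <-irrefl w-colour lt

  colour-run-degree : ∀ v c k → (∀ i → i ≤ k → ColorAt v (i + c)) → suc k ≤ degree G v
  colour-run-degree v c k run with colour-run-neighbours v c k run
  ... | L , len , uL , below =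
    subst (_≤ degree G v) len (neighbours-bound v L uL (All.map proj₁ below))

  module Degree4 (Δ≤4 : MaxDegreeAtMost G 4) where

    -- No vertex sees two colours four or more apart: in between it would
    -- see five consecutive colours, hence have degree at least 5.
    narrow-palette : ∀ v a b → 4 + a ≤ b → ColorAt v a → ColorAt v b → ⊥
    narrow-palette v a b a+4≤b ha hb = <-irrefl refl (≤-trans five≤deg (Δ≤4 v))
      where
      five≤deg : 5 ≤ degree G v
      five≤deg = colour-run-degree v a 4 λ i i≤4 →
        interval v a b (i + a) (m≤n+m a i) (≤-trans (+-monoˡ-≤ a i≤4) a+4≤b) ha hb

    Crosses : ℕ → Vertex → Set
    Crosses s v = ColorAt v s × ColorAt v (suc s)

    crosses-between : ∀ {v} s c d → c ≤ s → s < d → ColorAt v c → ColorAt v d → Crosses s v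
    crosses-between {v} s c d c≤s s<d hc hd =
      interval v c d s c≤s (≤-trans (n≤1+n s) s<d) hc hd ,
      interval v c d (suc s) (m≤n⇒m≤1+n c≤s) s<d hc hd

    walk-crosses : ∀ {P u v} s c d → Walk G P u v → c ≤ s → s < d →
                   ColorAt u c → ColorAt v d → ∃[ x ] (P x × Crosses s x)
    walk-crosses s c d (here pu) c≤s s<d hc hd = _ , pu , crosses-between s c d c≤s s<d hc hd
    walk-crosses s c d (step {u} {w} pu uw W) c≤s s<d hc hd with col u w ≤? s
    ... | yes uw≤s = walk-crosses s (col u w) d W uw≤s s<d (colourAt-other-end uw) hd
    ... | no  uw≰s = u , pu , crosses-between s c (col u w) c≤s (≰⇒> uw≰s) hc (w , uw , refl)

    end-avoiding : ∀ x {e f} → Adj G e f → ∃[ e' ] (e' ≢ x × ColorAt e' (col e f))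
    end-avoiding x {e} {f} ef with e ≟ᶠ x
    ... | yes refl = f , (λ f≡e → adj⇒≢ ef (sym f≡e)) , colourAt-other-end ef
    ... | no  e≢x  = e , e≢x , (f , ef , refl)

    -- In a 2-connected graph every level 1 ≤ s < t is crossed by two
    -- distinct vertices: a walk between edges of colours s and s+1 gives
    -- one, a walk avoiding it gives another.
    two-crossers : TwoConnected G → ∀ s → 1 ≤ s → suc s ≤ t →
                   ∃[ x ] ∃[ y ] (x ≢ y × Crosses s x × Crosses s y)
    two-crossers (_ , connected , no-cut) s 1≤s s<t
      with all-used s 1≤s (≤-trans (n≤1+n s) s<t) | all-used (suc s) (m≤n⇒m≤1+n 1≤s) s<t
    ... | e , f , ef , ef≡s | g , h , gh , gh≡s+1
      with walk-crosses s s (suc s) (connected e g) ≤-refl ≤-refl (f , ef , ef≡s) (h , gh , gh≡s+1)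
    ... | x , _ , x-crosses
      with end-avoiding x ef | end-avoiding x gh
    ... | e' , e'≢x , e'-sees | g' , g'≢x , g'-sees
      with walk-crosses s s (suc s) (no-cut x e' g' e'≢x g'≢x) ≤-refl ≤-refl
             (subst (ColorAt e') ef≡s e'-sees) (subst (ColorAt g') gh≡s+1 g'-sees)
    ... | y , y≢x , y-crosses = x , y , (λ x≡y → y≢x (sym x≡y)) , x-crosses , y-crosses

    InWindow : ℕ → ℕ → Vertex → Set
    InWindow r j = Crosses (r + 3 * j)

    InWindows : ℕ → ℕ → Vertex → Set
    InWindows r k v = ∃[ j ] (j < k × InWindow r j v)

    windows-apart : ∀ r i j → i < j → 4 + (r + 3 * i) ≤ suc (r + 3 * j)
    windows-apart r i j i<j = begin
      4 + (r + 3 * i)        ≡⟨ shift r i ⟩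
      suc (r + 3 * suc i)    ≤⟨ s≤s (+-monoʳ-≤ r (*-monoʳ-≤ 3 i<j)) ⟩
      suc (r + 3 * j)        ∎
      where
      open ≤-Reasoning
      shift : ∀ r i → 4 + (r + 3 * i) ≡ suc (r + 3 * suc i)
      shift = solve-∀

    window-unique : ∀ r i j v → InWindow r i v → InWindow r j v → i ≡ j
    window-unique r i j v (hi , hi+1) (hj , hj+1) with <-cmp i j
    ... | tri< i<j _ _ = ⊥-elim (narrow-palette v _ _ (windows-apart r i j i<j) hi hj+1)
    ... | tri≈ _ i≡j _ = i≡j
    ... | tri> _ _ j<i = ⊥-elim (narrow-palette v _ _ (windows-apart r j i j<i) hj hi+1)

    window-vertices : TwoConnected G → ∀ r k → 1 ≤ r → (∀ j → j < k → suc (r + 3 * j) ≤ t) →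
      Σ[ L ∈ List Vertex ] (length L ≡ k + k × Unique L × All (InWindows r k) L)
    window-vertices _ r zero _ _ = [] , refl , [] , []
    window-vertices tc r (suc k) 1≤r fits
      with window-vertices tc r k 1≤r (λ j j<k → fits j (m<n⇒m<1+n j<k))
    ... | L , len , uL , inL
      with two-crossers tc (r + 3 * k) (≤-trans 1≤r (m≤m+n r _)) (fits k ≤-refl)
    ... | x , y , x≢y , x-in , y-in =
      x ∷ y ∷ L , cong suc (trans (cong suc len) (sym (+-suc k k))) ,
      (x≢y ∷ fresh x-in) ∷ fresh y-in ∷ uL ,
      (k , ≤-refl , x-in) ∷ (k , ≤-refl , y-in) ∷ All.map earlier inL
      where
      fresh : ∀ {z} → InWindow r k z → All (z ≢_) L
      fresh {z} z-in = All.map (λ { {w} (j , j<k , w-in) refl → <-irrefl (window-unique r j k w w-in z-in) j<k }) inL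
      earlier : ∀ {w} → InWindows r k w → InWindows r (suc k) w
      earlier (j , j<k , w-in) = j , m<n⇒m<1+n j<k , w-in

    windows-fit : ∀ r k → r + 3 * k ≤ t + 2 → ∀ j → j < k → suc (r + 3 * j) ≤ t
    windows-fit r k budget j j<k = +-cancelˡ-≤ 3 _ _ (begin
      3 + suc (r + 3 * j)  ≡⟨ shift r j ⟩
      suc (r + 3 * suc j)  ≤⟨ s≤s (+-monoʳ-≤ r (*-monoʳ-≤ 3 j<k)) ⟩
      suc (r + 3 * k)      ≤⟨ s≤s budget ⟩
      suc (t + 2)          ≡⟨ +-comm (suc t) 2 ⟩
      3 + t                ∎)
      where
      open ≤-Reasoning
      shift : ∀ r j → 3 + suc (r + 3 * j) ≡ suc (r + 3 * suc j)
      shift = solve-∀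

    count : TwoConnected G → ∀ r k (E : List Vertex) → 1 ≤ r → r + 3 * k ≤ t + 2 →
            Unique E → All (λ v → ¬ InWindows r k v) E → length E + (k + k) ≤ n G
    count tc r k E 1≤r budget uE outside with window-vertices tc r k 1≤r (windows-fit r k budget)
    ... | L , len , uL , inL = begin
      length E + (k + k)        ≡⟨ cong (length E +_) len ⟨
      length E + length L       ≡⟨ length-++ E ⟨
      length (E ++ L)           ≤⟨ unique-⊆-length (E ++ L) (allFin (n G)) (++⁺ uE uL disjoint) (λ _ → ∈-allFin _) ⟩
      length (allFin (n G))     ≡⟨ length-tabulate (λ i → i) ⟩
      n G                       ∎
      where
      open ≤-Reasoning
      disjoint : ∀ {v} → ¬ (v ∈ E × v ∈ L)
      disjoint (v∈E , v∈L) = All.lookup outside v∈E (All.lookup inL v∈L)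

    crosses⇒outside-shifted : ∀ r k v → Crosses r v → ¬ InWindows (3 + r) k v
    crosses⇒outside-shifted r k v r-crossed (j , _ , j-crossed) =
      0≢1+n (window-unique r 0 (suc j) v r-in-window-0 j-in-window)
      where
      shift : ∀ r j → (3 + r) + 3 * j ≡ r + 3 * suc j
      shift = solve-∀
      r-in-window-0 : InWindow r 0 v
      r-in-window-0 = subst (λ s → Crosses s v) (sym (+-identityʳ r)) r-crossed
      j-in-window : InWindow r (suc j) v
      j-in-window = subst (λ s → Crosses s v) (shift r j) j-crossed

    within : ∀ {m u} → t ≡ u → m ≤ u + 2 → m ≤ t + 2
    within {m} t≡u = subst (λ u → m ≤ u + 2) (sym t≡u)

    three-crossers : TwoConnected G → ∀ s k a b p → (3 + s) + 3 * k ≤ t + 2 →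
                     a ≢ b → a ≢ p → b ≢ p → Crosses s a → Crosses s b → Crosses s p →
                     3 + (k + k) ≤ n G
    three-crossers tc s k a b p budget a≢b a≢p b≢p ca cb cp =
      count tc (3 + s) k (a ∷ b ∷ p ∷ []) (s≤s z≤n) budget
            ((a≢b ∷ a≢p ∷ []) ∷ (b≢p ∷ []) ∷ [] ∷ [])
            (out a ca ∷ out b cb ∷ out p cp ∷ [])
      where
      out : ∀ v → Crosses s v → ¬ InWindows (3 + s) k v
      out = crosses⇒outside-shifted s k

    -- The case t = 3K + 1 with K ≥ 1 needs one vertex beyond 2K.  Let ab be
    -- the edge of colour 1.  If a or b misses colour 3 it lies outside the
    -- windows of offset 2.  Otherwise a and b see 1, 2, 3; let p be the
    -- colour-2 neighbour of a.  If p sees 3 (resp. 1), then a, b, p all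
    -- cross level 2 (resp. 1); if p sees neither, p lies outside the
    -- windows of offset 1.
    one-more-vertex : TwoConnected G → ∀ k → t ≡ 1 + 3 * suc k → 1 + (suc k + suc k) ≤ n G
    one-more-vertex tc k t≡3K+1
      with all-used 1 ≤-refl (subst (1 ≤_) (sym t≡3K+1) (s≤s z≤n))
    ... | a , b , ab , ab≡1 = cases (colourAt? a 3) (colourAt? b 3)
      where
      K : ℕ
      K = suc k

      budget : ∀ {m} → m ≤ (1 + 3 * K) + 2 → m ≤ t + 2
      budget = within t≡3K+1

      misses-3 : ∀ v → ColorAt v 1 → ¬ ColorAt v 3 → 1 + (K + K) ≤ n G
      misses-3 v v1 ¬v3 = count tc 2 K (v ∷ []) (s≤s z≤n) (budget (offsets-fit-K k 2 (s≤s (s≤s z≤n))))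
        ([] ∷ []) (outside ∷ [])
        where
        outside : ¬ InWindows 2 K v
        outside (j , _ , _ , top) = missing-colour v 1 3 (3 + 3 * j) (s≤s z≤n) (m≤m+n 3 _) v1 ¬v3 top

      a1 : ColorAt a 1
      a1 = b , ab , ab≡1
      b1 : ColorAt b 1
      b1 = subst (ColorAt b) ab≡1 (colourAt-other-end ab)

      cases : Dec (ColorAt a 3) → Dec (ColorAt b 3) → 1 + (K + K) ≤ n G
      cases (no ¬a3) _        = misses-3 a a1 ¬a3
      cases (yes _)  (no ¬b3) = misses-3 b b1 ¬b3
      cases (yes a3) (yes b3) with interval a 1 3 2 (s≤s z≤n) (s≤s (s≤s z≤n)) a1 a3
      ... | p , ap , ap≡2 = p-cases (colourAt? p 3) (colourAt? p 1)
        where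
        a2 : ColorAt a 2
        a2 = p , ap , ap≡2
        b2 : ColorAt b 2
        b2 = interval b 1 3 2 (s≤s z≤n) (s≤s (s≤s z≤n)) b1 b3
        p2 : ColorAt p 2
        p2 = subst (ColorAt p) ap≡2 (colourAt-other-end ap)

        b≢p : b ≢ p
        b≢p refl with trans (sym ab≡1) ap≡2
        ... | ()

        three : ∀ s → s ≤ 3 → Crosses s a → Crosses s b → Crosses s p → 1 + (K + K) ≤ n G
        three s s≤3 ca cb cp = subst (_≤ n G) (three-plus-twice k)
          (three-crossers tc s k a b p (budget (offsets-fit-K-1 k (3 + s) (+-monoʳ-≤ 3 s≤3)))
                          (adj⇒≢ ab) (adj⇒≢ ap) b≢p ca cb cp)

        p-outside : ¬ ColorAt p 1 → ¬ ColorAt p 3 → ¬ InWindows 1 K p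
        p-outside ¬p1 ¬p3 (zero  , _ , p1 , _) = ¬p1 p1
        p-outside ¬p1 ¬p3 (suc j , _ , pj , _) =
          missing-colour p 2 3 (1 + 3 * suc j) (s≤s (s≤s z≤n)) (m≤n⇒m≤1+n (m≤m*n 3 (suc j))) p2 ¬p3 pj

        p-cases : Dec (ColorAt p 3) → Dec (ColorAt p 1) → 1 + (K + K) ≤ n G
        p-cases (yes p3) _         = three 2 (s≤s (s≤s z≤n)) (a2 , a3) (b2 , b3) (p2 , p3)
        p-cases (no _)   (yes p1)  = three 1 (s≤s z≤n) (a1 , a2) (b1 , b2) (p1 , p2)
        p-cases (no ¬p3) (no ¬p1)  = count tc 1 K (p ∷ []) ≤-refl (budget (offsets-fit-K k 1 (s≤s z≤n)))
          ([] ∷ []) (p-outside ¬p1 ¬p3 ∷ [])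

    twice-t-bound : TwoConnected G → 2 * t ≤ 3 * n G
    twice-t-bound tc with residue-3 t
    ... | k , inj₁ t≡3k = begin
      2 * t                      ≡⟨ cong (2 *_) t≡3k ⟩
      2 * (3 * k)                ≡⟨ residue-0-bound k ⟩
      3 * (k + k)                ≤⟨ *-monoʳ-≤ 3 (count tc 1 k [] ≤-refl (within t≡3k (residue-0-fit k)) [] []) ⟩
      3 * n G                    ∎
      where open ≤-Reasoning
    ... | k , inj₂ (inj₂ t≡3k+2) = begin
      2 * t                      ≡⟨ cong (2 *_) t≡3k+2 ⟩
      2 * (2 + 3 * k)            ≤⟨ residue-2-bound k ⟩
      3 * (suc k + suc k)        ≤⟨ *-monoʳ-≤ 3 (count tc 1 (suc k) [] ≤-refl (within t≡3k+2 (residue-2-fit k)) [] []) ⟩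
      3 * n G                    ∎
      where open ≤-Reasoning
    ... | zero , inj₂ (inj₁ t≡1) = begin
      2 * t                      ≡⟨ cong (2 *_) t≡1 ⟩
      2                          ≤⟨ ≤-by 7 refl ⟩
      3 * 3                      ≤⟨ *-monoʳ-≤ 3 (proj₁ tc) ⟩
      3 * n G                    ∎
      where open ≤-Reasoning
    ... | suc k , inj₂ (inj₁ t≡3K+1) = begin
      2 * t                      ≡⟨ cong (2 *_) t≡3K+1 ⟩
      2 * (1 + 3 * suc k)        ≤⟨ residue-1-bound k ⟩
      3 * (1 + (suc k + suc k))  ≤⟨ *-monoʳ-≤ 3 (one-more-vertex tc k t≡3K+1) ⟩
      3 * n G                    ∎
      where open ≤-Reasoning

-- Every interval t-colouring satisfies 2t ≤ 3|V(G)|.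
mainTheorem13 : (G : Graph) → TwoConnected G → Planar G → MaxDegreeAtMost G 4 →
                HasIntervalColoring G → WAtMostThreeHalvesV G
mainTheorem13 G tc _ Δ≤4 _ t C = twice-t-bound tc
  where open Colouring.Degree4 G t C Δ≤4
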